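{- Let $P=(X,\prec)$ be a poset on $n=|X|$ elements and $x\in\min(P)$. Then there exist a poset $Q=(Y,\prec')$ with $|Y|=n+1$ and $y\in\min(Q)$ such that $\rho(Q,y)=1+\rho(P,x)$.
   Context: For a finite poset $P$, $e(P)$ is its number of linear extensions; for a minimal element $x$ of $P$, $\rho(P,x):=e(P)/e(P-x)$, where $P-x$ is the subposet on $X\setminus\{x\}$. -}

module Defs where

open import Data.Nat using (ℕ; zero; suc)
open import Data.Fin using (Fin; punchIn; _<_)
open import Data.Fin.Properties using (all?; any?; _≟_; _<?_)
open import Data.List using (List; []; _∷_; map; concatMap; filter; length)
open import Data.Product using (_×_; ∃)
open import Data.Rational using (ℚ; 0ℚ; _/_)
open import Data.Integer using (+_)
import Data.Vec.Functional as VF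
open import Relation.Binary.PropositionalEquality using (_≡_)
open import Relation.Nullary using (¬_; Dec)
open import Relation.Nullary.Decidable using (_×-dec_; _→-dec_; ¬?)
open import Relation.Binary using (Decidable)

record Poset (n : ℕ) : Set₁ where
  field
    _≺_    : Fin n → Fin n → Set
    ≺-dec  : Decidable _≺_
    irrefl : ∀ a → ¬ (a ≺ a)
    trans  : ∀ {a b c} → a ≺ b → b ≺ c → a ≺ c
open Poset public

IsMinimal : ∀ {n} → Poset n → Fin n → Set
IsMinimal P x = ∀ z → ¬ (_≺_ P z x)

IsLinearExtension : ∀ {n} → Poset n → (Fin n → Fin n) → Set
IsLinearExtension {n} P σ =
  ((∀ a b → σ a ≡ σ b → a ≡ b) × (∀ k → ∃ λ a → σ a ≡ k))
  × (∀ a b → _≺_ P a b → σ a < σ b)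

isLinearExtension? : ∀ {n} (P : Poset n) (σ : Fin n → Fin n) → Dec (IsLinearExtension P σ)
isLinearExtension? P σ =
  ((all? λ a → all? λ b → (σ a ≟ σ b) →-dec (a ≟ b))
    ×-dec (all? λ k → any? λ a → σ a ≟ k))
  ×-dec (all? λ a → all? λ b → ≺-dec P a b →-dec (σ a <? σ b))

allFuns : (n m : ℕ) → List (Fin n → Fin m)
allFuns zero    m = (λ ()) ∷ []
allFuns (suc n) m = concatMap (λ i → map (λ f → i VF.∷ f) (allFuns n m)) (Data.List.allFin m)

e : ∀ {n} → Poset n → ℕ
e {n} P = length (filter (isLinearExtension? P) (allFuns n n))

_-_ : ∀ {m} → Poset (suc m) → Fin (suc m) → Poset m
P - x = record
  { _≺_    = λ a b → _≺_ P (punchIn x a) (punchIn x b)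
  ; ≺-dec  = λ a b → ≺-dec P (punchIn x a) (punchIn x b)
  ; irrefl = λ a → irrefl P (punchIn x a)
  ; trans  = trans P
  }

-- ρ(P,x) = e(P)/e(P-x) as a rational number. (e(P-x) ≥ 1 always holds, so
-- the zero branch is never used in substance; it only makes ρ total.)
ratio : ℕ → ℕ → ℚ
ratio a zero    = 0ℚ
ratio a (suc d) = (+ a) / suc d

ρ : ∀ {m} → Poset (suc m) → Fin (suc m) → ℚ
ρ P x = ratio (e P) (e (P - x))

-- Let Q arise from P by pushing x below every other element and adding a new
-- minimal element y below exactly the strict up-set of x in P.  The minimal
-- elements of Q are y and x, so a linear extension of Q starts with one of them:
-- e(Q) = e(Q - y) + e(Q - x).  Now Q - y is P with x as its minimum, whence
-- e(Q - y) = e(P - x), and Q - x ≅ P via y ↦ x, whence e(Q - x) = e(P).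
-- Dividing by e(Q - y) = e(P - x) ≥ 1 gives ρ(Q, y) = 1 + ρ(P, x).
module Submission where

open import Defs
open import Data.Nat using (ℕ; suc)
open import Data.Fin using (Fin)
open import Data.Product using (Σ; _×_)
open import Data.Rational using (1ℚ; _+_)
open import Relation.Binary.PropositionalEquality using (_≡_)

open import Data.Nat as ℕ using (zero; _≤_; s≤s)
open import Data.Nat.Properties as ℕ using (≤-antisym)
open import Data.Fin using (zero; suc; punchIn; punchOut; _<_)
open import Data.Fin.Properties
  using (_≟_; injective⇒≤; suc-injective; punchIn-injective; punchInᵢ≢i; punchIn-punchOut)
open import Data.Integer as ℤ using (+_)
open import Data.Integer.Tactic.RingSolver using (solve-∀)
import Data.Rational.Unnormalised as ℚᵘ
import Data.Rational.Unnormalised.Properties as ℚᵘ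
open import Data.Rational using (toℚᵘ)
open import Data.Rational.Properties using (toℚᵘ-fromℚᵘ; fromℚᵘ-toℚᵘ; fromℚᵘ-cong; toℚᵘ-homo-+)
open import Data.List using (List; []; _∷_; filter; length; lookup; allFin)
open import Data.List.Properties using (filter-≐; filter-some)
open import Data.List.Relation.Unary.All as All using ([]; _∷_)
import Data.List.Relation.Unary.All.Properties as All
open import Data.List.Relation.Unary.Any as Any using (here)
open import Data.List.Relation.Unary.Any.Properties using (lookup-index)
open import Data.List.Relation.Unary.AllPairs as AllPairs using (AllPairs; []; _∷_)
import Data.List.Relation.Unary.AllPairs.Properties as AllPairs
open import Data.List.Membership.Propositional using (_∈_)
open import Data.List.Membership.Propositional.Properties
  using (∈-map⁺; ∈-concatMap⁺; ∈-allFin; ∈-lookup; ∈-filter⁺; ∈-filter⁻)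
open import Data.Product using (_,_; proj₁; proj₂; ∃)
open import Data.Sum using (_⊎_; inj₁; inj₂)
open import Data.Empty using (⊥; ⊥-elim)
import Data.Vec.Functional as Vector
open import Function using (_∘_; id)
open import Level using (0ℓ)
open import Relation.Binary.PropositionalEquality
  using (_≢_; _≗_; refl; sym; cong; cong₂; subst; subst₂; module ≡-Reasoning)
  renaming (trans to ≡-trans)
open import Relation.Nullary using (¬_; Dec; yes; no)
open import Relation.Nullary.Decidable using (_×-dec_; _⊎-dec_; ¬?)
open import Relation.Unary using (Pred; Decidable; _∩_)
open import Relation.Unary.Properties using (_∩?_; ∁?)

Fn : ℕ → ℕ → Set
Fn n m = Fin n → Fin m

count : ∀ {n m} {p : Pred (Fn n m) 0ℓ} → Decidable p → ℕ
count {n} {m} p? = length (filter p? (allFuns n m))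

allFuns-distinct : ∀ n m → AllPairs (λ f g → ¬ f ≗ g) (allFuns n m)
allFuns-distinct zero    m = [] ∷ []
allFuns-distinct (suc n) m =
  AllPairs.concat⁺
    (All.map⁺ (All.universal (λ i → AllPairs.map⁺ (AllPairs.map differInTail (allFuns-distinct n m))) (allFin m)))
    (AllPairs.map⁺ (AllPairs.tabulate⁺ λ i≢j →
      All.map⁺ (All.universal (λ _ → All.map⁺ (All.universal (λ _ f≗g → i≢j (f≗g zero)) _)) _)))
  where
  differInTail : ∀ {i : Fin m} {f g} → ¬ f ≗ g → ¬ (i Vector.∷ f) ≗ (i Vector.∷ g)
  differInTail f≉g eq = f≉g (eq ∘ suc)

allFuns-complete : ∀ n m (f : Fn n m) → Σ (Fn n m) λ g → g ∈ allFuns n m × g ≗ f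
allFuns-complete zero    m f = (λ ()) , here refl , λ ()
allFuns-complete (suc n) m f with allFuns-complete n m (f ∘ suc)
... | g , g∈ , g≗ =
  f zero Vector.∷ g ,
  ∈-concatMap⁺ _ (Any.map (λ { refl → ∈-map⁺ _ g∈ }) (∈-allFin (f zero))) ,
  λ { zero → refl ; (suc a) → g≗ a }

lookup-injective : ∀ {n m} {fs : List (Fn n m)} → AllPairs (λ f g → ¬ f ≗ g) fs →
  ∀ i j → lookup fs i ≗ lookup fs j → i ≡ j
lookup-injective (_  ∷ _)   zero    zero    _  = refl
lookup-injective (px ∷ _)   zero    (suc j) eq = ⊥-elim (All.lookup px (∈-lookup j) eq)
lookup-injective (px ∷ _)   (suc i) zero    eq = ⊥-elim (All.lookup px (∈-lookup i) (sym ∘ eq))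
lookup-injective (_  ∷ pxs) (suc i) (suc j) eq = cong suc (lookup-injective pxs i j eq)

count-≤ : ∀ {n m n′ m′} {p : Pred (Fn n m) 0ℓ} {q : Pred (Fn n′ m′) 0ℓ}
  (p? : Decidable p) (q? : Decidable q) → (∀ {f g} → f ≗ g → q f → q g) →
  (F : ∀ f → p f → Fn n′ m′) → (∀ f pf → q (F f pf)) →
  (∀ f g pf pg → F f pf ≗ F g pg → f ≗ g) → count p? ≤ count q?
count-≤ {n} {m} {n′} {m′} {p} p? q? q-resp F F-sound F-injective =
  injective⇒≤ {f = proj₁ ∘ image} λ {i} {j} → image-injective i j
  where
  ps : List (Fn n m)
  ps = filter p? (allFuns n m)

  qs : List (Fn n′ m′)
  qs = filter q? (allFuns n′ m′)

  p-lookup : ∀ i → p (lookup ps i)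
  p-lookup i = proj₂ (∈-filter⁻ p? {xs = allFuns n m} (∈-lookup i))

  G : Fin (length ps) → Fn n′ m′
  G i = F (lookup ps i) (p-lookup i)

  image : ∀ i → Σ (Fin (length qs)) λ j → lookup qs j ≗ G i
  image i with allFuns-complete n′ m′ (G i)
  ... | g , g∈ , g≗ = Any.index g∈qs , λ a → ≡-trans (cong (λ h → h a) (sym (lookup-index g∈qs))) (g≗ a)
    where
    g∈qs : g ∈ qs
    g∈qs = ∈-filter⁺ q? g∈ (q-resp (sym ∘ g≗) (F-sound _ (p-lookup i)))

  image-injective : ∀ i j → proj₁ (image i) ≡ proj₁ (image j) → i ≡ j
  image-injective i j eq =
    lookup-injective (AllPairs.filter⁺ p? (allFuns-distinct n m)) i j
      (F-injective _ _ _ _ λ a →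
        ≡-trans (sym (proj₂ (image i) a)) (≡-trans (cong (λ k → lookup qs k a) eq) (proj₂ (image j) a)))

count-cong : ∀ {n m} {p q : Pred (Fn n m) 0ℓ} (p? : Decidable p) (q? : Decidable q) →
  (∀ {f} → p f → q f) → (∀ {f} → q f → p f) → count p? ≡ count q?
count-cong {n} {m} p? q? p⇒q q⇒p = cong length (filter-≐ p? q? (p⇒q , q⇒p) (allFuns n m))

length-filter-split : ∀ {A : Set} {p r : Pred A 0ℓ} (p? : Decidable p) (r? : Decidable r) xs →
  length (filter p? xs) ≡ length (filter (p? ∩? r?) xs) ℕ.+ length (filter (p? ∩? ∁? r?) xs)
length-filter-split p? r? [] = refl
length-filter-split p? r? (x ∷ xs) with p? x | r? x
... | yes _ | yes _ = cong suc (length-filter-split p? r? xs)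
... | yes _ | no  _ = ≡-trans (cong suc (length-filter-split p? r? xs)) (sym (ℕ.+-suc _ _))
... | no  _ | _     = length-filter-split p? r? xs

count-split : ∀ {n m} {p r : Pred (Fn n m) 0ℓ} (p? : Decidable p) (r? : Decidable r) →
  count p? ≡ count (p? ∩? r?) ℕ.+ count (p? ∩? ∁? r?)
count-split {n} {m} p? r? = length-filter-split p? r? (allFuns n m)

count-pos : ∀ {n m} {p : Pred (Fn n m) 0ℓ} (p? : Decidable p) → (∀ {f g} → f ≗ g → p f → p g) →
  ∀ f → p f → 1 ≤ count p?
count-pos {n} {m} p? p-resp f pf with allFuns-complete n m f
... | g , g∈ , g≗ = filter-some p? (Any.map (λ { refl → p-resp (sym ∘ g≗) pf }) g∈)

module _ {k} (P : Poset k) where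

  isLinearExtension-resp-≗ : ∀ {σ σ′} → σ ≗ σ′ → IsLinearExtension P σ → IsLinearExtension P σ′
  isLinearExtension-resp-≗ {σ} {σ′} eq ((inj , surj) , mono) =
    ((λ a b e → inj a b (≡-trans (eq a) (≡-trans e (sym (eq b))))) ,
     (λ i → proj₁ (surj i) , ≡-trans (sym (eq _)) (proj₂ (surj i)))) ,
    (λ a b a≺b → subst₂ _<_ (eq a) (eq b) (mono a b a≺b))

module _ {k} (P : Poset (suc k)) where

  first-isMinimal : ∀ {σ z} → IsLinearExtension P σ → σ z ≡ zero → IsMinimal P z
  first-isMinimal {σ} (_ , mono) σz≡0 w w≺z = ℕ.n≮0 (subst (σ w <_) σz≡0 (mono w _ w≺z))

  StartsWith : Fin (suc k) → Pred (Fn (suc k) (suc k)) 0ℓ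
  StartsWith c = IsLinearExtension P ∩ λ σ → σ c ≡ zero

  startsWith? : ∀ c → Decidable (StartsWith c)
  startsWith? c = isLinearExtension? P ∩? λ σ → σ c ≟ zero

data PunchView {k} (c : Fin (suc k)) : Fin (suc k) → Set where
  at   : PunchView c c
  away : (a : Fin k) → PunchView c (punchIn c a)

punchView : ∀ {k} (c z : Fin (suc k)) → PunchView c z
punchView c z with c ≟ z
... | yes refl = at
... | no c≢z   = subst (PunchView c) (punchIn-punchOut c≢z) (away (punchOut c≢z))

prepend : ∀ {k} → Fin (suc k) → Fn k k → Fn (suc k) (suc k)
prepend c σ z with c ≟ z
... | yes _  = zero
... | no c≢z = suc (σ (punchOut c≢z))

prepend-at : ∀ {k} (c : Fin (suc k)) σ → prepend c σ c ≡ zero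
prepend-at c σ with c ≟ c
... | yes _  = refl
... | no c≢c = ⊥-elim (c≢c refl)

prepend-away : ∀ {k} (c : Fin (suc k)) σ a → prepend c σ (punchIn c a) ≡ suc (σ a)
prepend-away c σ a with c ≟ punchIn c a
... | yes c≡ = ⊥-elim (punchInᵢ≢i c a (sym c≡))
... | no c≢  = cong (suc ∘ σ) (punchIn-injective c _ _ (punchIn-punchOut c≢))

module _ {k} (P : Poset (suc k)) {c : Fin (suc k)} where

  prepend-isLinearExtension : IsMinimal P c → ∀ σ → IsLinearExtension (P - c) σ →
    StartsWith P c (prepend c σ)
  prepend-isLinearExtension c-min σ ((inj , surj) , mono) =
    ((injective , surjective) , monotone) , prepend-at c σ
    where
    injective : ∀ z z′ → prepend c σ z ≡ prepend c σ z′ → z ≡ z′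
    injective z z′ eq with punchView c z | punchView c z′
    ... | at     | at      = refl
    ... | at     | away b  rewrite prepend-at c σ | prepend-away c σ b with () ← eq
    ... | away a | at      rewrite prepend-at c σ | prepend-away c σ a with () ← eq
    ... | away a | away b  rewrite prepend-away c σ a | prepend-away c σ b =
      cong (punchIn c) (inj a b (suc-injective eq))

    surjective : ∀ i → ∃ λ z → prepend c σ z ≡ i
    surjective zero    = c , prepend-at c σ
    surjective (suc i) = punchIn c (proj₁ (surj i)) , ≡-trans (prepend-away c σ _) (cong suc (proj₂ (surj i)))

    monotone : ∀ z z′ → _≺_ P z z′ → prepend c σ z < prepend c σ z′
    monotone z z′ z≺z′ with punchView c z | punchView c z′
    ... | _      | at     = ⊥-elim (c-min z z≺z′)
    ... | at     | away b rewrite prepend-at c σ | prepend-away c σ b = ℕ.z<s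
    ... | away a | away b rewrite prepend-away c σ a | prepend-away c σ b = s≤s (mono a b z≺z′)

  module _ {τ : Fn (suc k) (suc k)} (τ-starts : StartsWith P c τ) where

    private
      τ-injective : ∀ a b → τ a ≡ τ b → a ≡ b
      τ-injective = proj₁ (proj₁ (proj₁ τ-starts))

      τ-surjective : ∀ i → ∃ λ a → τ a ≡ i
      τ-surjective = proj₂ (proj₁ (proj₁ τ-starts))

      τ-monotone : ∀ a b → _≺_ P a b → τ a < τ b
      τ-monotone = proj₂ (proj₁ τ-starts)

      τ-away≢0 : ∀ a → zero ≢ τ (punchIn c a)
      τ-away≢0 a 0≡τ = punchInᵢ≢i c a (τ-injective _ _ (≡-trans (sym 0≡τ) (sym (proj₂ τ-starts))))

    restrict : Fn k k
    restrict a = punchOut (τ-away≢0 a)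

    restrict-spec : ∀ a → suc (restrict a) ≡ τ (punchIn c a)
    restrict-spec a = punchIn-punchOut (τ-away≢0 a)

    restrict-isLinearExtension : IsLinearExtension (P - c) restrict
    restrict-isLinearExtension = (injective , surjective) , monotone
      where
      injective : ∀ a b → restrict a ≡ restrict b → a ≡ b
      injective a b eq = punchIn-injective c a b
        (τ-injective _ _ (≡-trans (sym (restrict-spec a)) (≡-trans (cong suc eq) (restrict-spec b))))

      surjective : ∀ i → ∃ λ a → restrict a ≡ i
      surjective i with τ-surjective (suc i)
      ... | z , τz≡ with punchView c z
      ...   | at     with () ← ≡-trans (sym (proj₂ τ-starts)) τz≡
      ...   | away a = a , suc-injective (≡-trans (restrict-spec a) τz≡)

      monotone : ∀ a b → _≺_ (P - c) a b → restrict a < restrict b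
      monotone a b a≺b =
        ℕ.s<s⁻¹ (subst₂ _<_ (sym (restrict-spec a)) (sym (restrict-spec b)) (τ-monotone _ _ a≺b))

  restrict-injective : ∀ τ τ′ (st : StartsWith P c τ) (st′ : StartsWith P c τ′) →
    restrict st ≗ restrict st′ → τ ≗ τ′
  restrict-injective τ τ′ st st′ eq z with punchView c z
  ... | at     = ≡-trans (proj₂ st) (sym (proj₂ st′))
  ... | away a = ≡-trans (sym (restrict-spec st a)) (≡-trans (cong suc (eq a)) (restrict-spec st′ a))

  count-startsWith : IsMinimal P c → count (startsWith? P c) ≡ e (P - c)
  count-startsWith c-min = ≤-antisym
    (count-≤ (startsWith? P c) (isLinearExtension? (P - c)) (isLinearExtension-resp-≗ (P - c))
      (λ _ st → restrict st) (λ _ st → restrict-isLinearExtension st) restrict-injective)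
    (count-≤ (isLinearExtension? (P - c)) (startsWith? P c)
      (λ eq (le , σc≡0) → isLinearExtension-resp-≗ P eq le , ≡-trans (sym (eq c)) σc≡0)
      (λ σ _ → prepend c σ) (prepend-isLinearExtension c-min)
      (λ σ σ′ _ _ eq a → suc-injective
        (≡-trans (sym (prepend-away c σ a)) (≡-trans (eq (punchIn c a)) (prepend-away c σ′ a)))))

minimal-exists : ∀ k (P : Poset (suc k)) → Σ (Fin (suc k)) (IsMinimal P)
minimal-exists zero    P = zero , λ { zero r → irrefl P zero r }
minimal-exists (suc k) P with minimal-exists k (P - zero)
... | c , c-min with ≺-dec P zero (suc c)
...   | yes 0≺c = zero , λ { zero r → irrefl P zero r ; (suc z) r → c-min z (trans P r 0≺c) }
...   | no  0⊀c = suc c , λ { zero r → 0⊀c r ; (suc z) r → c-min z r }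

linearExtension-exists : ∀ k (P : Poset k) → Σ (Fn k k) (IsLinearExtension P)
linearExtension-exists zero    P = (λ ()) , ((λ ()) , (λ ())) , (λ ())
linearExtension-exists (suc k) P with minimal-exists k P
... | c , c-min with linearExtension-exists k (P - c)
...   | σ , σ-ext = prepend c σ , proj₁ (prepend-isLinearExtension P c-min σ σ-ext)

1≤e : ∀ {k} (P : Poset k) → 1 ≤ e P
1≤e {k} P = count-pos (isLinearExtension? P) (isLinearExtension-resp-≗ P) _ (proj₂ (linearExtension-exists k P))

module _ {k} (P : Poset (suc k)) where

  e-minimum : ∀ {c} → IsMinimal P c → (∀ z → IsMinimal P z → z ≡ c) → e P ≡ e (P - c)
  e-minimum {c} c-min only-c =
    ≡-trans (count-cong (isLinearExtension? P) (startsWith? P c) (λ le → le , starts le) proj₁)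
            (count-startsWith P c-min)
    where
    starts : ∀ {σ} → IsLinearExtension P σ → σ c ≡ zero
    starts {σ} le@((_ , surj) , _) with surj zero
    ... | z , σz≡0 = subst (λ w → σ w ≡ zero) (only-c z (first-isMinimal P le σz≡0)) σz≡0

  e-twoMinimal : ∀ {y x} → IsMinimal P y → IsMinimal P x → y ≢ x →
    (∀ z → IsMinimal P z → z ≡ y ⊎ z ≡ x) → e P ≡ e (P - y) ℕ.+ e (P - x)
  e-twoMinimal {y} {x} y-min x-min y≢x only-y-x = begin
    e P
      ≡⟨ count-split (isLinearExtension? P) (λ σ → σ y ≟ zero) ⟩
    count (startsWith? P y) ℕ.+ count (isLinearExtension? P ∩? ∁? (λ σ → σ y ≟ zero))
      ≡⟨ cong (count (startsWith? P y) ℕ.+_) (count-cong _ (startsWith? P x) notY⇒x x⇒notY) ⟩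
    count (startsWith? P y) ℕ.+ count (startsWith? P x)
      ≡⟨ cong₂ ℕ._+_ (count-startsWith P y-min) (count-startsWith P x-min) ⟩
    e (P - y) ℕ.+ e (P - x) ∎
    where
    open ≡-Reasoning
    notY⇒x : ∀ {σ} → IsLinearExtension P σ × σ y ≢ zero → StartsWith P x σ
    notY⇒x (le@((_ , surj) , _) , σy≢0) with surj zero
    ... | z , σz≡0 with only-y-x z (first-isMinimal P le σz≡0)
    ...   | inj₁ refl = ⊥-elim (σy≢0 σz≡0)
    ...   | inj₂ refl = le , σz≡0
    x⇒notY : ∀ {σ} → StartsWith P x σ → IsLinearExtension P σ × σ y ≢ zero
    x⇒notY (le@((inj , _) , _) , σx≡0) = le , λ σy≡0 → y≢x (inj _ _ (≡-trans σy≡0 (sym σx≡0)))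

record _≅_ {k} (A B : Poset k) : Set where
  field
    to        : Fin k → Fin k
    from      : Fin k → Fin k
    from∘to   : ∀ a → from (to a) ≡ a
    to∘from   : ∀ b → to (from b) ≡ b
    to-mono   : ∀ a a′ → _≺_ A a a′ → _≺_ B (to a) (to a′)
    from-mono : ∀ b b′ → _≺_ B b b′ → _≺_ A (from b) (from b′)

≅-sym : ∀ {k} {A B : Poset k} → A ≅ B → B ≅ A
≅-sym A≅B = record { to = from ; from = to ; from∘to = to∘from ; to∘from = from∘to
                   ; to-mono = from-mono ; from-mono = to-mono }
  where open _≅_ A≅B

e-≤-≅ : ∀ {k} {A B : Poset k} → A ≅ B → e A ≤ e B
e-≤-≅ {A = A} {B} A≅B =
  count-≤ (isLinearExtension? A) (isLinearExtension? B) (isLinearExtension-resp-≗ B)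
    (λ σ _ → σ ∘ from) transport
    (λ σ σ′ _ _ eq a → ≡-trans (cong σ (sym (from∘to a))) (≡-trans (eq (to a)) (cong σ′ (from∘to a))))
  where
  open _≅_ A≅B
  transport : ∀ σ → IsLinearExtension A σ → IsLinearExtension B (σ ∘ from)
  transport σ ((inj , surj) , mono) =
    ((λ b b′ eq → ≡-trans (sym (to∘from b)) (≡-trans (cong to (inj _ _ eq)) (to∘from b′))) ,
     (λ i → to (proj₁ (surj i)) , ≡-trans (cong σ (from∘to _)) (proj₂ (surj i)))) ,
    (λ b b′ b≺b′ → mono _ _ (from-mono b b′ b≺b′))

e-≅ : ∀ {k} {A B : Poset k} → A ≅ B → e A ≡ e B
e-≅ A≅B = ≤-antisym (e-≤-≅ A≅B) (e-≤-≅ (≅-sym A≅B))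

ratio-+ : ∀ d a → 1 ≤ d → ratio (d ℕ.+ a) d ≡ 1ℚ + ratio a d
ratio-+ (suc d) a _ = ≡-trans (fromℚᵘ-cong unnormalised) (fromℚᵘ-toℚᵘ _)
  where
  identity : ∀ (D A : ℤ.ℤ) → (D ℤ.+ A) ℤ.* (+ 1 ℤ.* D) ≡ (+ 1 ℤ.* D ℤ.+ A ℤ.* + 1) ℤ.* D
  identity = solve-∀
  unnormalised : ℚᵘ.mkℚᵘ (+ (suc d ℕ.+ a)) d ℚᵘ.≃ toℚᵘ (1ℚ + ratio a (suc d))
  unnormalised = ℚᵘ.≃-trans (ℚᵘ.*≡* (identity (+ suc d) (+ a)))
    (ℚᵘ.≃-sym (ℚᵘ.≃-trans (toℚᵘ-homo-+ 1ℚ (ratio a (suc d)))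
                          (ℚᵘ.+-cong ℚᵘ.≃-refl (toℚᵘ-fromℚᵘ (ℚᵘ.mkℚᵘ (+ a) d)))))

module Construction {m} (P : Poset (suc m)) (x : Fin (suc m)) (x-min : IsMinimal P x) where

  _≺⁺_ : Fin (suc m) → Fin (suc m) → Set
  a ≺⁺ b = _≺_ P a b ⊎ (a ≡ x × b ≢ x)

  ≺⁺-irrefl : ∀ a → ¬ a ≺⁺ a
  ≺⁺-irrefl a (inj₁ a≺a)       = irrefl P a a≺a
  ≺⁺-irrefl a (inj₂ (a≡x , a≢x)) = a≢x a≡x

  ≺⁺-trans : ∀ {a b c} → a ≺⁺ b → b ≺⁺ c → a ≺⁺ c
  ≺⁺-trans     (inj₁ a≺b)       (inj₁ b≺c)          = inj₁ (trans P a≺b b≺c)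
  ≺⁺-trans {a} (inj₁ a≺b)       (inj₂ (refl , _))   = ⊥-elim (x-min a a≺b)
  ≺⁺-trans {b = b} (inj₂ (a≡x , _)) (inj₁ b≺c)      = inj₂ (a≡x , λ { refl → x-min b b≺c })
  ≺⁺-trans     (inj₂ (_ , b≢x)) (inj₂ (b≡x , _))    = ⊥-elim (b≢x b≡x)

  P⁺ : Poset (suc m)
  P⁺ = record
    { _≺_ = _≺⁺_ ; ≺-dec = λ a b → ≺-dec P a b ⊎-dec ((a ≟ x) ×-dec ¬? (b ≟ x))
    ; irrefl = ≺⁺-irrefl ; trans = ≺⁺-trans }

  x-minimum⁺ : ∀ z → IsMinimal P⁺ z → z ≡ x
  x-minimum⁺ z z-min with z ≟ x
  ... | yes z≡x = z≡x
  ... | no  z≢x = ⊥-elim (z-min x (inj₂ (refl , z≢x)))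

  x-minimal⁺ : IsMinimal P⁺ x
  x-minimal⁺ z (inj₁ z≺x)       = x-min z z≺x
  x-minimal⁺ z (inj₂ (_ , x≢x)) = x≢x refl

  P⁺-x≅P-x : (P⁺ - x) ≅ (P - x)
  P⁺-x≅P-x = record
    { to = id ; from = id ; from∘to = λ _ → refl ; to∘from = λ _ → refl
    ; to-mono = to-mono ; from-mono = λ _ _ → inj₁ }
    where
    to-mono : ∀ a b → _≺_ (P⁺ - x) a b → _≺_ (P - x) a b
    to-mono a b (inj₁ a≺b)      = a≺b
    to-mono a b (inj₂ (a≡x , _)) = ⊥-elim (punchInᵢ≢i x a a≡x)

  -- The new element y is zero; the old element a of P is suc a.
  _⊏_ : Fin (suc (suc m)) → Fin (suc (suc m)) → Set
  zero  ⊏ suc b = _≺_ P x b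
  suc a ⊏ suc b = a ≺⁺ b
  _     ⊏ zero  = ⊥

  ⊏-dec : ∀ a b → Dec (a ⊏ b)
  ⊏-dec zero    (suc b) = ≺-dec P x b
  ⊏-dec (suc a) (suc b) = ≺-dec P⁺ a b
  ⊏-dec zero    zero    = no λ ()
  ⊏-dec (suc a) zero    = no λ ()

  ⊏-irrefl : ∀ a → ¬ a ⊏ a
  ⊏-irrefl zero    ()
  ⊏-irrefl (suc a) = ≺⁺-irrefl a

  ⊏-trans : ∀ {a b c} → a ⊏ b → b ⊏ c → a ⊏ c
  ⊏-trans {zero}  {suc _} {suc _} x≺b (inj₁ b≺c)        = trans P x≺b b≺c
  ⊏-trans {zero}  {suc _} {suc _} x≺x (inj₂ (refl , _)) = ⊥-elim (irrefl P x x≺x)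
  ⊏-trans {suc _} {suc _} {suc _} a≺b b≺c               = ≺⁺-trans a≺b b≺c
  ⊏-trans {_}     {suc _} {zero}  _ ()
  ⊏-trans {zero}  {zero}          ()
  ⊏-trans {suc _} {zero}          ()

  Q : Poset (suc (suc m))
  Q = record { _≺_ = _⊏_ ; ≺-dec = ⊏-dec ; irrefl = ⊏-irrefl ; trans = λ {a} {b} {c} → ⊏-trans {a} {b} {c} }

  y-minimal : IsMinimal Q zero
  y-minimal zero    ()
  y-minimal (suc _) ()

  x-minimal : IsMinimal Q (suc x)
  x-minimal zero    x≺x               = irrefl P x x≺x
  x-minimal (suc a) (inj₁ a≺x)        = x-min a a≺x
  x-minimal (suc a) (inj₂ (_ , x≢x))  = x≢x refl

  minimal-y-or-x : ∀ z → IsMinimal Q z → z ≡ zero ⊎ z ≡ suc x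
  minimal-y-or-x zero    _ = inj₁ refl
  minimal-y-or-x (suc b) b-min with b ≟ x
  ... | yes b≡x = inj₂ (cong suc b≡x)
  ... | no  b≢x = ⊥-elim (b-min (suc x) (inj₂ (refl , b≢x)))

  Q-x≅P : (Q - suc x) ≅ P
  Q-x≅P = record
    { to = to ; from = prepend x id ; from∘to = from∘to ; to∘from = to∘from
    ; to-mono = to-mono ; from-mono = from-mono }
    where
    to : Fin (suc m) → Fin (suc m)
    to zero    = x
    to (suc a) = punchIn x a

    from∘to : ∀ a → prepend x id (to a) ≡ a
    from∘to zero    = prepend-at x id
    from∘to (suc a) = prepend-away x id a

    to∘from : ∀ b → to (prepend x id b) ≡ b
    to∘from b with punchView x b
    ... | at     = cong to (prepend-at x id)
    ... | away a = cong to (prepend-away x id a)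

    to-mono : ∀ a a′ → _≺_ (Q - suc x) a a′ → _≺_ P (to a) (to a′)
    to-mono zero    (suc _) x≺b              = x≺b
    to-mono (suc _) (suc _) (inj₁ a≺b)       = a≺b
    to-mono (suc a) (suc _) (inj₂ (a≡x , _)) = ⊥-elim (punchInᵢ≢i x a a≡x)

    from-mono : ∀ b b′ → _≺_ P b b′ → _≺_ (Q - suc x) (prepend x id b) (prepend x id b′)
    from-mono b b′ b≺b′ with punchView x b | punchView x b′
    ... | _      | at     = ⊥-elim (x-min b b≺b′)
    ... | at     | away a′ rewrite prepend-at x id | prepend-away x id a′ = b≺b′
    ... | away a | away a′ rewrite prepend-away x id a | prepend-away x id a′ = inj₁ b≺b′

  e-Q-y : e (Q - zero) ≡ e (P - x)
  e-Q-y = ≡-trans (e-minimum P⁺ x-minimal⁺ x-minimum⁺) (e-≅ P⁺-x≅P-x)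

  e-Q : e Q ≡ e (P - x) ℕ.+ e P
  e-Q = ≡-trans (e-twoMinimal Q y-minimal x-minimal (λ ()) minimal-y-or-x)
                (cong₂ ℕ._+_ e-Q-y (e-≅ Q-x≅P))

lemma7p5 : (m : ℕ) (P : Poset (suc m)) (x : Fin (suc m)) → IsMinimal P x →
    Σ (Poset (suc (suc m))) λ Q → Σ (Fin (suc (suc m))) λ y →
      IsMinimal Q y × ρ Q y ≡ 1ℚ + ρ P x
lemma7p5 m P x x-min = Q , zero , y-minimal , (begin
  ratio (e Q) (e (Q - zero))            ≡⟨ cong₂ ratio e-Q e-Q-y ⟩
  ratio (e (P - x) ℕ.+ e P) (e (P - x)) ≡⟨ ratio-+ (e (P - x)) (e P) (1≤e (P - x)) ⟩
  1ℚ + ratio (e P) (e (P - x))          ∎)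
  where
  open Construction P x x-min
  open ≡-Reasoning
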